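{- For every $1\le i\le n$, if $\alpha$ is a patient instance of option $j$ alive at $i$ and $\beta$ is an impatient instance of option $j'$ alive at $i$, then $j<j'$. That is, within $\mathbb{O}_i$ the patient options are all smaller than the impatient options.
   Context: Items $1,\ldots,n$ with weights $w_i\ge0$, parameters $s_i\ge0$, and threshold $w_0$. Write $W_{a,b}=\sum_{a\le v\le b}w_v$, $S_{a,b}=\max\{s_v: a\le v\le b\}$. For $1\le i\le n$ let $O_i=\{j:0\le j<i,\ W_{j+1,i}\le w_0\}$ and $\mathbb{O}_i=\{j\in O_i: j>0,\ s_j>S_{j+1,i}\}$ (the s-maximal options of $i$). For $j\in\mathbb{O}_i$ let $\mathrm{next}_i(j)$ be the smallest element of $\mathbb{O}_i$ larger than $j$, or $i$ if there is none. An instance of option $j$ is a pair $(j,[a,e])$ where $[a,e]$ is a maximal interval of consecutive indices $i$ such that $j\in\mathbb{O}_i$ for all $i\in[a,e]$ and $\mathrm{next}_i(j)$ is constant on $[a,e]$ (when $\mathrm{next}_i(j)$ changes, $j$ is renewed and a new instance begins); the instance is alive at each $i\in[a,e]$. The instance is patient if $e=n$ or $W_{j+1,e+1}>w_0$ (it leaves because of the weight constraint, this being checked first), and impatient otherwise (it leaves because $s_j\le s_{e+1}$, or because $\mathrm{next}(j)$ changes).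
   Formalization: The weights $w_i$, the parameters $s_i$ and the threshold $w_0$ take rational values. -}

module Defs where

open import Data.Nat as ℕ using (ℕ; zero; suc; _∸_)
open import Data.Rational as ℚ using (ℚ; 0ℚ)
open import Data.List using (List; []; _∷_; foldr; map; applyUpTo)
open import Data.Product using (Σ; _×_; ∃; ∃-syntax; _,_)
open import Data.Sum using (_⊎_)
open import Relation.Nullary using (¬_)
open import Relation.Binary.PropositionalEquality using (_≡_)

-- The list of indices a, a+1, ..., b (empty if b < a).
range : ℕ → ℕ → List ℕ
range a b = applyUpTo (a ℕ.+_) (suc b ∸ a)

sumℚ : List ℚ → ℚ
sumℚ = foldr ℚ._+_ 0ℚ

-- A problem instance: weights w, parameters s, threshold w₀.
-- Items are indexed 1..n by natural numbers; values outside 1..n are irrelevant.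
module Instance (n : ℕ) (w s : ℕ → ℚ) (w₀ : ℚ) where

  W : ℕ → ℕ → ℚ
  W a b = sumℚ (map w (range a b))

  -- s_j > S_{j+1,i} = max{ s_v : j+1 ≤ v ≤ i }  (interval nonempty since j < i)
  SDom : ℕ → ℕ → Set
  SDom j i = ∀ v → suc j ℕ.≤ v → v ℕ.≤ i → s v ℚ.< s j

  InO : ℕ → ℕ → Set
  InO i j = j ℕ.< i × W (suc j) i ℚ.≤ w₀

  InOO : ℕ → ℕ → Set
  InOO i j = InO i j × (0 ℕ.< j × SDom j i)

  IsNext : ℕ → ℕ → ℕ → Set
  IsNext i j k =
      (InOO i k × j ℕ.< k × (∀ m → j ℕ.< m → m ℕ.< k → ¬ InOO i m))
    ⊎ (k ≡ i × (∀ m → j ℕ.< m → ¬ InOO i m))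

  -- (j , [a , e]) is an instance of option j: [a,e] ⊆ [1,n] is a maximal
  -- interval on which j ∈ 𝕆_i and next_i(j) is constant.
  record IsInstance (j a e : ℕ) : Set where
    field
      1≤a   : 1 ℕ.≤ a
      a≤e   : a ℕ.≤ e
      e≤n   : e ℕ.≤ n
      nxt   : ℕ
      inOO  : ∀ i → a ℕ.≤ i → i ℕ.≤ e → InOO i j
      const : ∀ i → a ℕ.≤ i → i ℕ.≤ e → IsNext i j nxt
      maxL  : a ≡ 1 ⊎ ¬ (InOO (a ∸ 1) j × IsNext (a ∸ 1) j nxt)
      maxR  : e ≡ n ⊎ ¬ (InOO (suc e) j × IsNext (suc e) j nxt)

  Patient : ℕ → ℕ → ℕ → Set
  Patient j a e = e ≡ n ⊎ w₀ ℚ.< W (suc j) (suc e)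

  Impatient : ℕ → ℕ → ℕ → Set
  Impatient j a e = ¬ Patient j a e

  AliveAt : ℕ → ℕ → ℕ → Set
  AliveAt a e i = a ℕ.≤ i × i ℕ.≤ e

-- Suppose j′ ≤ j for a patient instance (j, [a, e]) and an impatient instance
-- (j′, [a′, e′]) alive at the same i.  Being impatient, (j′, [a′, e′]) ends before n
-- with W_{j′+1,e′+1} ≤ w₀.  If it ended before e, at e′+1 the larger option j would
-- still be s-maximal; as s_{e′+1} < s_j ≤ s_{j′}, the option j′ and its successor
-- (which lies between j′ and j) would survive to e′+1 with the same successor,
-- contradicting maximality of [a′, e′].  So e ≤ e′, and since weights are
-- nonnegative, W_{j+1,e+1} ≤ W_{j′+1,e′+1} ≤ w₀ with e < n: (j, [a, e]) is not patient.
module Submission where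

open import Defs
open import Data.Nat as ℕ using (ℕ; zero; suc; _∸_; z≤n; s≤s; _≤′_; ≤′-refl; ≤′-step)
import Data.Nat.Properties as ℕₚ
open import Data.Rational as ℚ using (ℚ; 0ℚ)
import Data.Rational.Properties as ℚₚ
open import Data.List using ([]; _∷_; _∷ʳ_; map; applyUpTo)
open import Data.List.Properties using (applyUpTo-∷ʳ)
open import Data.Product using (_×_; _,_; proj₁; proj₂)
open import Data.Sum using (inj₁; inj₂)
open import Data.Empty using (⊥-elim)
open import Function using (_∘_)
open import Relation.Nullary using (yes; no; ¬_)
open import Relation.Binary using (tri<; tri≈; tri>)
open import Relation.Binary.PropositionalEquality
  using (_≡_; refl; sym; trans; cong; cong₂; subst; module ≡-Reasoning)

applyUpTo-cong : ∀ {A : Set} {f g : ℕ → A} → (∀ x → f x ≡ g x) →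
                 ∀ k → applyUpTo f k ≡ applyUpTo g k
applyUpTo-cong f≗g zero    = refl
applyUpTo-cong f≗g (suc k) = cong₂ _∷_ (f≗g 0) (applyUpTo-cong (f≗g ∘ suc) k)

range-empty : ∀ {a b} → b ℕ.< a → range a b ≡ []
range-empty {a} b<a = cong (applyUpTo (a ℕ.+_)) (ℕₚ.m≤n⇒m∸n≡0 b<a)

range-∷ : ∀ {a b} → a ℕ.≤ b → range a b ≡ a ∷ range (suc a) b
range-∷ {a} {b} a≤b = begin
  applyUpTo (a ℕ.+_) (suc b ∸ a)
    ≡⟨ cong (applyUpTo (a ℕ.+_)) (ℕₚ.+-∸-assoc 1 a≤b) ⟩
  a ℕ.+ 0 ∷ applyUpTo (λ x → a ℕ.+ suc x) (b ∸ a)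
    ≡⟨ cong₂ _∷_ (ℕₚ.+-identityʳ a) (applyUpTo-cong (ℕₚ.+-suc a) (b ∸ a)) ⟩
  a ∷ range (suc a) b
    ∎
  where open ≡-Reasoning

range-∷ʳ : ∀ {a b} → a ℕ.≤ suc b → range a (suc b) ≡ range a b ∷ʳ suc b
range-∷ʳ {a} {b} a≤1+b = begin
  applyUpTo (a ℕ.+_) (suc (suc b) ∸ a)
    ≡⟨ cong (applyUpTo (a ℕ.+_)) (ℕₚ.+-∸-assoc 1 a≤1+b) ⟩
  applyUpTo (a ℕ.+_) (suc (suc b ∸ a))
    ≡⟨ sym (applyUpTo-∷ʳ (a ℕ.+_) (suc b ∸ a)) ⟩
  range a b ∷ʳ (a ℕ.+ (suc b ∸ a))
    ≡⟨ cong (range a b ∷ʳ_) (ℕₚ.m+[n∸m]≡n a≤1+b) ⟩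
  range a b ∷ʳ suc b
    ∎
  where open ≡-Reasoning

p≤q+p : ∀ {p q} → 0ℚ ℚ.≤ q → p ℚ.≤ q ℚ.+ p
p≤q+p {p} {q} 0≤q = begin
  p        ≡⟨ sym (ℚₚ.+-identityˡ p) ⟩
  0ℚ ℚ.+ p ≤⟨ ℚₚ.+-monoˡ-≤ p 0≤q ⟩
  q ℚ.+ p  ∎
  where open ℚₚ.≤-Reasoning

module _ (w : ℕ → ℚ) where

  NonNegOn : ℕ → ℕ → Set
  NonNegOn a b = ∀ v → a ℕ.≤ v → v ℕ.≤ b → 0ℚ ℚ.≤ w v

  private
    W : ℕ → ℕ → ℚ
    W a b = sumℚ (map w (range a b))

  NonNegOn-⊆ : ∀ {a a′ b b′} → a ℕ.≤ a′ → b′ ℕ.≤ b → NonNegOn a b → NonNegOn a′ b′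
  NonNegOn-⊆ a≤a′ b′≤b nonneg v a′≤v v≤b′ =
    nonneg v (ℕₚ.≤-trans a≤a′ a′≤v) (ℕₚ.≤-trans v≤b′ b′≤b)

  sum-map-∷ʳ-mono : ∀ xs {x} → 0ℚ ℚ.≤ w x → sumℚ (map w xs) ℚ.≤ sumℚ (map w (xs ∷ʳ x))
  sum-map-∷ʳ-mono []       0≤wx = p≤q+p 0≤wx
  sum-map-∷ʳ-mono (y ∷ xs) 0≤wx = ℚₚ.+-monoʳ-≤ (w y) (sum-map-∷ʳ-mono xs 0≤wx)

  W-shrinkˡ : ∀ {a b} → NonNegOn a b → W (suc a) b ℚ.≤ W a b
  W-shrinkˡ {a} {b} nonneg with a ℕ.≤? b
  ... | yes a≤b = ℚₚ.≤-trans (p≤q+p (nonneg a ℕₚ.≤-refl a≤b))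
                             (ℚₚ.≤-reflexive (cong (sumℚ ∘ map w) (sym (range-∷ a≤b))))
  ... | no a≰b  = ℚₚ.≤-reflexive (cong (sumℚ ∘ map w) both-empty)
    where
    b<a : b ℕ.< a
    b<a = ℕₚ.≰⇒> a≰b
    both-empty : range (suc a) b ≡ range a b
    both-empty = trans (range-empty (ℕₚ.m<n⇒m<1+n b<a)) (sym (range-empty b<a))

  W-extendʳ : ∀ {a b} → NonNegOn a (suc b) → W a b ℚ.≤ W a (suc b)
  W-extendʳ {a} {b} nonneg with a ℕ.≤? suc b
  ... | yes a≤1+b = ℚₚ.≤-trans (sum-map-∷ʳ-mono (range a b) (nonneg (suc b) a≤1+b ℕₚ.≤-refl))
                               (ℚₚ.≤-reflexive (cong (sumℚ ∘ map w) (sym (range-∷ʳ a≤1+b))))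
  ... | no a≰1+b  = ℚₚ.≤-reflexive (cong (sumℚ ∘ map w) both-empty)
    where
    1+b<a : suc b ℕ.< a
    1+b<a = ℕₚ.≰⇒> a≰1+b
    both-empty : range a b ≡ range a (suc b)
    both-empty = trans (range-empty (ℕₚ.<-trans (ℕₚ.n<1+n b) 1+b<a)) (sym (range-empty 1+b<a))

  W-monoˡ : ∀ {a a′ b} → NonNegOn a b → a ≤′ a′ → W a′ b ℚ.≤ W a b
  W-monoˡ nonneg ≤′-refl         = ℚₚ.≤-refl
  W-monoˡ nonneg (≤′-step a≤′a″) =
    ℚₚ.≤-trans (W-shrinkˡ (NonNegOn-⊆ (ℕₚ.≤′⇒≤ a≤′a″) ℕₚ.≤-refl nonneg)) (W-monoˡ nonneg a≤′a″)

  W-monoʳ : ∀ {a b b′} → NonNegOn a b → b′ ≤′ b → W a b′ ℚ.≤ W a b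
  W-monoʳ nonneg ≤′-refl          = ℚₚ.≤-refl
  W-monoʳ nonneg (≤′-step b′≤′b″) =
    ℚₚ.≤-trans (W-monoʳ (NonNegOn-⊆ ℕₚ.≤-refl (ℕₚ.n≤1+n _) nonneg) b′≤′b″) (W-extendʳ nonneg)

  W-mono : ∀ {a a′ b b′} → NonNegOn a b → a ℕ.≤ a′ → b′ ℕ.≤ b → W a′ b′ ℚ.≤ W a b
  W-mono nonneg a≤a′ b′≤b =
    ℚₚ.≤-trans (W-monoˡ (NonNegOn-⊆ ℕₚ.≤-refl b′≤b nonneg) (ℕₚ.≤⇒≤′ a≤a′))
               (W-monoʳ nonneg (ℕₚ.≤⇒≤′ b′≤b))

module Options (n : ℕ) (w s : ℕ → ℚ) (w₀ : ℚ) (w≥0 : NonNegOn w 1 n) where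
  open Instance n w s w₀

  SDom⇒s≤ : ∀ {j i v} → SDom j i → j ℕ.≤ v → v ℕ.≤ i → s v ℚ.≤ s j
  SDom⇒s≤ dom j≤v v≤i with ℕₚ.m≤n⇒m<n∨m≡n j≤v
  ... | inj₁ j<v  = ℚₚ.<⇒≤ (dom _ j<v v≤i)
  ... | inj₂ refl = ℚₚ.≤-refl

  SDom-extend : ∀ {j i} → SDom j i → s (suc i) ℚ.< s j → SDom j (suc i)
  SDom-extend dom s₁₊ᵢ<sⱼ v j<v v≤1+i with ℕₚ.m≤n⇒m<n∨m≡n v≤1+i
  ... | inj₁ v<1+i = dom v j<v (ℕₚ.≤-pred v<1+i)
  ... | inj₂ refl  = s₁₊ᵢ<sⱼ

  SDom-restrict : ∀ {j i i′} → i′ ℕ.≤ i → SDom j i → SDom j i′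
  SDom-restrict i′≤i dom v j<v v≤i′ = dom v j<v (ℕₚ.≤-trans v≤i′ i′≤i)

  InOO-extend : ∀ {i j} → InOO i j → W (suc j) (suc i) ℚ.≤ w₀ → s (suc i) ℚ.< s j →
                InOO (suc i) j
  InOO-extend ((j<i , _) , 0<j , dom) fits s₁₊ᵢ<sⱼ =
    (ℕₚ.m<n⇒m<1+n j<i , fits) , 0<j , SDom-extend dom s₁₊ᵢ<sⱼ

  InOO-restrict : ∀ {i j} → suc i ℕ.≤ n → j ℕ.< i → InOO (suc i) j → InOO i j
  InOO-restrict {i} {j} 1+i≤n j<i ((_ , fits) , 0<j , dom) =
    (j<i , ℚₚ.≤-trans W≤ fits) , 0<j , SDom-restrict (ℕₚ.n≤1+n i) dom
    where
    W≤ : W (suc j) i ℚ.≤ W (suc j) (suc i)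
    W≤ = W-mono w {a = suc j} (NonNegOn-⊆ w (s≤s z≤n) 1+i≤n w≥0) ℕₚ.≤-refl (ℕₚ.n≤1+n i)

  IsNext-unique : ∀ {i j k k′} → IsNext i j k → IsNext i j k′ → k ≡ k′
  IsNext-unique {k = k} {k′} (inj₁ (k∈ , j<k , minimal)) (inj₁ (k′∈ , j<k′ , minimal′))
    with ℕₚ.<-cmp k k′
  ... | tri< k<k′ _ _ = ⊥-elim (minimal′ k j<k k<k′ k∈)
  ... | tri≈ _ k≡k′ _ = k≡k′
  ... | tri> _ _ k′<k = ⊥-elim (minimal k′ j<k′ k′<k k′∈)
  IsNext-unique (inj₁ (k∈ , j<k , _)) (inj₂ (_ , none)) = ⊥-elim (none _ j<k k∈)
  IsNext-unique (inj₂ (_ , none)) (inj₁ (k∈ , j<k , _)) = ⊥-elim (none _ j<k k∈)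
  IsNext-unique (inj₂ (k≡i , _)) (inj₂ (k′≡i , _))     = trans k≡i (sym k′≡i)

  IsNext-≤ : ∀ {i j k m} → IsNext i j k → j ℕ.< m → InOO i m → k ℕ.≤ m
  IsNext-≤ (inj₁ (_ , _ , minimal)) j<m m∈ = ℕₚ.≮⇒≥ (λ m<k → minimal _ j<m m<k m∈)
  IsNext-≤ (inj₂ (_ , none))        j<m m∈ = ⊥-elim (none _ j<m m∈)

  IsNext-extend : ∀ {i j k} → suc i ℕ.≤ n → k ℕ.< i → IsNext i j k → InOO (suc i) k →
                  IsNext (suc i) j k
  IsNext-extend 1+i≤n k<i (inj₁ (_ , j<k , minimal)) k∈ =
    inj₁ (k∈ , j<k , λ m j<m m<k m∈ →
      minimal m j<m m<k (InOO-restrict 1+i≤n (ℕₚ.<-trans m<k k<i) m∈))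
  IsNext-extend _ k<i (inj₂ (refl , _)) _ = ⊥-elim (ℕₚ.<-irrefl refl k<i)

  -- The successor x of j′ lies between j′ and j, so s_{e+1} < s_j ≤ s_x, s_{j′}.
  option-survives : ∀ {i e j j′ x} → suc e ℕ.≤ n → i ℕ.≤ e → j′ ℕ.< j →
                    InOO i j → InOO (suc e) j → InOO e j′ → W (suc j′) (suc e) ℚ.≤ w₀ →
                    IsNext i j′ x → IsNext e j′ x →
                    InOO (suc e) j′ × IsNext (suc e) j′ x
  option-survives {i} {e} {j} {j′} {x} 1+e≤n i≤e j′<j j∈ᵢ j∈ j′∈ fits nextᵢ next =
    InOO-extend j′∈ fits (ℚₚ.<-≤-trans s₁₊ₑ<sⱼ (SDom⇒s≤ (proj₂ (proj₂ j′∈)) (ℕₚ.<⇒≤ j′<j) j≤e)) ,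
    IsNext-extend 1+e≤n x<e next (next-survives next)
    where
    j<e : j ℕ.< e
    j<e = ℕₚ.<-≤-trans (proj₁ (proj₁ j∈ᵢ)) i≤e
    j≤e : j ℕ.≤ e
    j≤e = ℕₚ.<⇒≤ j<e
    x≤j : x ℕ.≤ j
    x≤j = IsNext-≤ nextᵢ j′<j j∈ᵢ
    x<e : x ℕ.< e
    x<e = ℕₚ.≤-<-trans x≤j j<e
    s₁₊ₑ<sⱼ : s (suc e) ℚ.< s j
    s₁₊ₑ<sⱼ = proj₂ (proj₂ j∈) (suc e) (s≤s j≤e) ℕₚ.≤-refl
    next-survives : IsNext e j′ x → InOO (suc e) x
    next-survives (inj₁ (x∈ , j′<x , _)) =
      InOO-extend x∈
        (ℚₚ.≤-trans (W-mono w (NonNegOn-⊆ w (s≤s z≤n) 1+e≤n w≥0) (s≤s (ℕₚ.<⇒≤ j′<x)) ℕₚ.≤-refl)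
                    fits)
        (ℚₚ.<-≤-trans s₁₊ₑ<sⱼ (SDom⇒s≤ (proj₂ (proj₂ x∈)) x≤j j≤e))
    next-survives (inj₂ (refl , _)) = ⊥-elim (ℕₚ.<-irrefl refl x<e)

  impatient-fits : ∀ {j a e} → Impatient j a e → W (suc j) (suc e) ℚ.≤ w₀
  impatient-fits impatient = ℚₚ.≮⇒≥ (impatient ∘ inj₂)

  impatient-ends-early : ∀ {j a e} → IsInstance j a e → Impatient j a e → suc e ℕ.≤ n
  impatient-ends-early α impatient = ℕₚ.≤∧≢⇒< (IsInstance.e≤n α) (impatient ∘ inj₁)

  impatient-stops : ∀ {j a e} (α : IsInstance j a e) → Impatient j a e →
                    ¬ (InOO (suc e) j × IsNext (suc e) j (IsInstance.nxt α))
  impatient-stops α impatient with IsInstance.maxR α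
  ... | inj₁ e≡n     = ⊥-elim (impatient (inj₁ e≡n))
  ... | inj₂ maximal = maximal

  impatient-outlives : ∀ {i j a e j′ a′ e′} →
                       IsInstance j a e → AliveAt a e i →
                       (β : IsInstance j′ a′ e′) → Impatient j′ a′ e′ → AliveAt a′ e′ i →
                       j′ ℕ.≤ j → e ℕ.≤ e′
  impatient-outlives {i} {j} {a} {e} {j′} {a′} {e′} α (a≤i , i≤e) β impatient (a′≤i , i≤e′) j′≤j =
    ℕₚ.≮⇒≥ (λ e′<e → impatient-stops β impatient (survives e′<e))
    where
    module α = IsInstance α
    module β = IsInstance β
    a≤1+e′ : a ℕ.≤ suc e′
    a≤1+e′ = ℕₚ.≤-trans a≤i (ℕₚ.≤-trans i≤e′ (ℕₚ.n≤1+n e′))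
    survives : e′ ℕ.< e → InOO (suc e′) j′ × IsNext (suc e′) j′ β.nxt
    survives e′<e with ℕₚ.m≤n⇒m<n∨m≡n j′≤j
    ... | inj₂ refl =
      α.inOO _ a≤1+e′ e′<e ,
      subst (IsNext (suc e′) j) (IsNext-unique (α.const i a≤i i≤e) (β.const i a′≤i i≤e′))
            (α.const _ a≤1+e′ e′<e)
    ... | inj₁ j′<j =
      option-survives (impatient-ends-early β impatient) i≤e′ j′<j
        (α.inOO i a≤i i≤e) (α.inOO _ a≤1+e′ e′<e) (β.inOO e′ a′≤e′ ℕₚ.≤-refl)
        (impatient-fits {j′} {a′} {e′} impatient) (β.const i a′≤i i≤e′) (β.const e′ a′≤e′ ℕₚ.≤-refl)
      where
      a′≤e′ : a′ ℕ.≤ e′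
      a′≤e′ = ℕₚ.≤-trans a′≤i i≤e′

  ¬Patient-within : ∀ {j a e j′ e′} → j′ ℕ.≤ j → e ℕ.≤ e′ → suc e′ ℕ.≤ n →
                    W (suc j′) (suc e′) ℚ.≤ w₀ → ¬ Patient j a e
  ¬Patient-within j′≤j e≤e′ 1+e′≤n fits (inj₁ refl) =
    ℕₚ.<-irrefl refl (ℕₚ.≤-<-trans e≤e′ 1+e′≤n)
  ¬Patient-within {j} {e = e} {j′} {e′} j′≤j e≤e′ 1+e′≤n fits (inj₂ heavy) =
    ℚₚ.<-irrefl refl (ℚₚ.<-≤-trans heavy (ℚₚ.≤-trans W≤ fits))
    where
    W≤ : W (suc j) (suc e) ℚ.≤ W (suc j′) (suc e′)
    W≤ = W-mono w (NonNegOn-⊆ w (s≤s z≤n) 1+e′≤n w≥0) (s≤s j′≤j) (s≤s e≤e′)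

lemma3 : (n : ℕ) (w s : ℕ → ℚ) (w₀ : ℚ)
         → (∀ v → 1 ℕ.≤ v → v ℕ.≤ n → 0ℚ ℚ.≤ w v)
         → (∀ v → 1 ℕ.≤ v → v ℕ.≤ n → 0ℚ ℚ.≤ s v)
         → ∀ i → 1 ℕ.≤ i → i ℕ.≤ n
         → ∀ j a e j′ a′ e′
         → Instance.IsInstance n w s w₀ j a e
         → Instance.Patient n w s w₀ j a e
         → Instance.AliveAt n w s w₀ a e i
         → Instance.IsInstance n w s w₀ j′ a′ e′
         → Instance.Impatient n w s w₀ j′ a′ e′
         → Instance.AliveAt n w s w₀ a′ e′ i
         → j ℕ.< j′
lemma3 n w s w₀ w≥0 _ i _ _ j a e j′ a′ e′ α patient alive β impatient alive′ =
  ℕₚ.≰⇒> λ j′≤j →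
    ¬Patient-within {a = a} j′≤j (impatient-outlives α alive β impatient alive′ j′≤j)
      (impatient-ends-early β impatient) (impatient-fits {j′} {a′} {e′} impatient) patient
  where open Options n w s w₀ w≥0
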